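{- Let $f(t)=\sum_{k\ge1}\frac{c_k}{k!}t^k\in\mathbb{K}[[t]]$ with $c_1\neq0$, and write $g(t)=t/f(t)=\sum_{k\ge0}\frac{a_k}{k!}t^k$. If $P\in\mathcal{T}[t]$ is the solution of \[ P'=\langle g(D)\,|\,P\rangle\curvearrowright P,\qquad P(0)=\bullet, \] then $a:=\langle g(D)|P\rangle\in\mathcal{T}$ satisfies $a=\sum_{k\ge0}\frac{a_k}{k!}(a\curvearrowright\#)^k(\bullet)$, and hence $a=f_\curvearrowright^{ -1}(\bullet)$.
   Context: $\mathbb{K}$ is a field of characteristic zero. A rooted tree is a finite (non-planar) tree with a distinguished vertex, the root. Let $\mathcal{T}(n)$ be the vector space spanned by isomorphism classes of rooted trees with $n$ vertices and $\mathcal{T}=\prod_{n\ge1}\mathcal{T}(n)$, filtered by $F^p\mathcal{T}=\prod_{n\ge p}\mathcal{T}(n)$. For rooted trees $T,T'$ set $T\curvearrowright T'=\sum_{v\in V(T')}T\searrow_v T'$, where $T\searrow_vT'$ is obtained from the disjoint union of $T$ and $T'$ by adding an edge from the root of $T$ to $v$, with the root of $T'$ as root; extended bilinearly (this is a complete pre-Lie algebra). $\bullet$ denotes the one-vertex tree. For $x\in\mathcal{T}$, $(x\curvearrowright\#)^k(y)=x\curvearrowright(x\curvearrowright(\cdots(x\curvearrowright y)\cdots))$ ($k$ times), $x^{\curvearrowright k}=(x\curvearrowright\#)^{k-1}(x)$, and $f_\curvearrowright(x)=\sum_{k\ge1}\frac{c_k}{k!}x^{\curvearrowright k}$; $f_\curvearrowright\colon\mathcal{T}\to\mathcal{T}$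 is a bijection with inverse $f^{ -1}_\curvearrowright$. $\mathcal{T}[t]$ denotes formal sums $\sum_T P(T)(t)\,T$ with $P(T)(t)\in\mathbb{K}[t]$, with $\curvearrowright$ extended $\mathbb{K}[t]$-bilinearly and $'$ the $t$-derivative applied coefficientwise; $P(0)$ means evaluation at $t=0$. $\langle g(D)|\cdot\rangle\colon\mathbb{K}[t]\to\mathbb{K}$ is the linear functional $t^n\mapsto a_n$, extended coefficientwise to $\mathcal{T}[t]\to\mathcal{T}$. -}

module Defs where

open import Level using (Level; _⊔_) renaming (suc to lsuc)
open import Data.Nat using (ℕ; zero; suc; _∸_; _≤_)
open import Data.Nat using (_!)
open import Data.Bool using (Bool; true; false; if_then_else_; _∧_)
open import Data.List using (List; []; _∷_; [_]; map; concatMap; _++_; filter; upTo; foldr; length)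
open import Data.Product using (∃)
open import Relation.Nullary using (¬_)
open import Relation.Nullary.Decidable using (yes; no)
open import Relation.Binary.PropositionalEquality using (_≡_)
open import Algebra.Bundles using (CommutativeRing)
open import Data.Bool.Properties using (T?)

record Field (c ℓ : Level) : Set (lsuc (c ⊔ ℓ)) where
  field
    commutativeRing : CommutativeRing c ℓ
  open CommutativeRing commutativeRing public
  field
    _⁻¹      : Carrier → Carrier
    ⁻¹-inverse : ∀ x → ¬ (x ≈ 0#) → (x * (x ⁻¹)) ≈ 1#
    0≉1      : ¬ (0# ≈ 1#)

-- Planar rooted trees; non-planar rooted trees (isomorphism classes)
-- are represented by canonical forms: children recursively canonical
-- and sorted by a fixed total order.

data RTree : Set where
  node : List RTree → RTree

data Ord3 : Set where
  lt eq gt : Ord3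

mutual
  size : RTree → ℕ
  size (node ts) = suc (sizes ts)

  sizes : List RTree → ℕ
  sizes [] = zero
  sizes (t ∷ ts) = size t Data.Nat.+ sizes ts

mutual
  cmp : RTree → RTree → Ord3
  cmp (node ts) (node us) = cmpL ts us

  cmpL : List RTree → List RTree → Ord3
  cmpL [] [] = eq
  cmpL [] (_ ∷ _) = lt
  cmpL (_ ∷ _) [] = gt
  cmpL (t ∷ ts) (u ∷ us) with cmp t u
  ... | lt = lt
  ... | gt = gt
  ... | eq = cmpL ts us

eqB : RTree → RTree → Bool
eqB t u with cmp t u
... | eq = true
... | _  = false

insertT : RTree → List RTree → List RTree
insertT t [] = t ∷ []
insertT t (u ∷ us) with cmp t u
... | gt = u ∷ insertT t us
... | _  = t ∷ u ∷ us

sortT : List RTree → List RTree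
sortT [] = []
sortT (t ∷ ts) = insertT t (sortT ts)

mutual
  canon : RTree → RTree
  canon (node ts) = node (sortT (canonL ts))

  canonL : List RTree → List RTree
  canonL [] = []
  canonL (t ∷ ts) = canon t ∷ canonL ts

isoB : RTree → RTree → Bool
isoB t u = eqB (canon t) (canon u)

-- enumeration of all planar rooted trees with n vertices
-- (fuel argument first; use fuel n)
mutual
  treesF : ℕ → ℕ → List RTree
  treesF zero _ = []
  treesF (suc f) zero = []
  treesF (suc f) (suc n) = map node (forestsF f n)

  -- ordered forests with m vertices in total
  forestsF : ℕ → ℕ → List (List RTree)
  forestsF _ zero = [ [] ]
  forestsF zero (suc m) = []
  forestsF (suc f) (suc m) =
    concatMap (λ k → concatMap (λ t → map (t ∷_) (forestsF f (suc m ∸ suc k)))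
                                (treesF (suc f) (suc k)))
              (upTo (suc m))

reps : ℕ → List RTree
reps n = filter (λ p → T? (eqB (canon p) p)) (treesF n n)

bullet : RTree
bullet = node []

mutual
  graftAt : RTree → RTree → List RTree
  graftAt T (node cs) = node (T ∷ cs) ∷ map node (graftL T cs)

  graftL : RTree → List RTree → List (List RTree)
  graftL T [] = []
  graftL T (c ∷ cs) = map (_∷ cs) (graftAt T c) ++ map (c ∷_) (graftL T cs)

module Series {c ℓ : Level} (F : Field c ℓ) where
  open Field F public hiding (zero)

  sumL : List Carrier → Carrier
  sumL = foldr _+_ 0#

  natK : ℕ → Carrier
  natK zero = 0#
  natK (suc n) = 1# + natK n

  CharZero : Set ℓ
  CharZero = ∀ n → ¬ (natK (suc n) ≈ 0#)

  -- an element of 𝒯 = ∏_n 𝒯(n): a coefficient for every isomorphism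
  -- class; the coefficient of the class of S is  x (canon S)
  Ser : Set c
  Ser = RTree → Carrier

  _≈ᵀ_ : Ser → Ser → Set ℓ
  x ≈ᵀ y = ∀ S → x (canon S) ≈ y (canon S)

  zeroS : Ser
  zeroS _ = 0#

  _·ₛ_ : Carrier → Ser → Ser
  (λ' ·ₛ x) S = λ' * x S

  bulletS : Ser
  bulletS S = if isoB S bullet then 1# else 0#

  -- x ↷ y, bilinear extension of T ↷ T' = Σ_v T ↘_v T'; coefficient of
  -- the class of S (only pairs of classes with total size |S| contribute)
  _↷_ : Ser → Ser → Ser
  (x ↷ y) S =
    sumL (concatMap (λ i →
           concatMap (λ T →
             concatMap (λ T' →
               map (λ U → if isoB U S then x T * y T' else 0#) (graftAt T T'))
               (reps (size S ∸ i)))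
             (reps i))
         (upTo (size S)))

  iter↷ : Ser → ℕ → Ser → Ser
  iter↷ x zero y = y
  iter↷ x (suc k) y = x ↷ iter↷ x k y

  -- x^{↷k} = (x ↷ #)^{k-1}(x)  (k ≥ 1; the k = 0 value is unused)
  pow↷ : Ser → ℕ → Ser
  pow↷ x zero = zeroS
  pow↷ x (suc k) = iter↷ x k x

  -- Σ_k u_k = s in the complete filtered space 𝒯: for each tree, the
  -- partial sums of the coefficients are eventually equal to that of s
  HasSum : (ℕ → Ser) → Ser → Set ℓ
  HasSum u s = ∀ S → ∃ λ N → ∀ M → N ≤ M →
                 sumL (map (λ k → u k (canon S)) (upTo M)) ≈ s (canon S)

  -- polynomials in t (coefficient lists, constant term first)
  Poly : Set c
  Poly = List Carrier

  coeff : Poly → ℕ → Carrier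
  coeff [] _ = 0#
  coeff (x ∷ p) zero = x
  coeff (x ∷ p) (suc m) = coeff p m

  derivFrom : ℕ → Poly → Poly
  derivFrom n [] = []
  derivFrom n (y ∷ q) = (natK n * y) ∷ derivFrom (suc n) q

  deriv : Poly → Poly
  deriv [] = []
  deriv (_ ∷ p) = derivFrom 1 p

  -- ⟨ g(D) | · ⟩ : t^n ↦ a n
  pairFrom : (ℕ → Carrier) → ℕ → Poly → Carrier
  pairFrom a n [] = 0#
  pairFrom a n (y ∷ q) = (y * a n) + pairFrom a (suc n) q

  pairing : (ℕ → Carrier) → Poly → Carrier
  pairing a = pairFrom a zero

  SerT : Set c
  SerT = RTree → Poly

  derivT : SerT → SerT
  derivT P S = deriv (P S)

  pairingT : (ℕ → Carrier) → SerT → Ser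
  pairingT a P S = pairing a (P S)

  atDeg : SerT → ℕ → Ser
  atDeg P m S = coeff (P S) m

  -- K[t]-bilinear extension of ↷ with a t-independent left argument:
  -- x ↷ P, given coefficientwise in t
  _↷ₜ_ : Ser → SerT → (ℕ → Ser)
  (x ↷ₜ P) m = x ↷ atDeg P m

  factK : ℕ → Carrier
  factK k = natK (k !)

  fCoeff : (ℕ → Carrier) → ℕ → Carrier
  fCoeff c' zero = 0#
  fCoeff c' (suc k) = c' (suc k) * (factK (suc k) ⁻¹)

  gCoeff : (ℕ → Carrier) → ℕ → Carrier
  gCoeff a k = a k * (factK k ⁻¹)

  tCoeff : ℕ → Carrier
  tCoeff (suc zero) = 1#
  tCoeff _ = 0#

  FTimesGIsT : (ℕ → Carrier) → (ℕ → Carrier) → Set ℓ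
  FTimesGIsT c' a = ∀ n →
    sumL (map (λ i → fCoeff c' i * gCoeff a (n ∸ i)) (upTo (suc n))) ≈ tCoeff n

  FArrow : (ℕ → Carrier) → Ser → Ser → Set ℓ
  FArrow c' x y = HasSum (λ k → fCoeff c' k ·ₛ pow↷ x k) y

-- Comparing coefficients of t^k in P' = a ↷ P, P(0) = •, gives (a ↷ #)^k(•) = k! P_k, hence
-- a = Σ_k a_k P_k = Σ_k (a_k/k!) (a ↷ #)^k(•).  Substituting this expansion of a into
-- a^{↷(k+1)} = (a ↷ #)^k(a) gives Σ_j (a_j/j!) (a ↷ #)^{k+j}(•), and collecting the terms
-- (a ↷ #)^m(•) in Σ_k (c_k/k!) a^{↷k} produces the coefficients of t^{m+1} in f g = t, so only
-- (a ↷ #)^0(•) = • survives.  Every sum is finite tree by tree: P has polynomial coefficients, and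
-- x ↷ y at a tree S only involves the coefficients of y at trees with at most |S| vertices.
module Submission where

open import Defs
open import Data.Nat as ℕ using (ℕ; zero; suc; _∸_; _≤_; _<_; z≤n; s≤s; _!)
open import Data.Product using (_×_; ∃; _,_; proj₁; proj₂)
open import Relation.Nullary using (¬_)
import Data.Nat.Properties as ℕₚ
open import Data.Fin using (toℕ)
open import Data.Fin.Properties using (toℕ<n)
open import Data.List using (List; []; _∷_; map; concatMap; _++_; foldr; length; upTo; applyUpTo)
open import Data.List.Properties using (map-concatMap; map-∘)
open import Data.List.Membership.Propositional using (_∈_; find; lose)
open import Data.List.Membership.Propositional.Properties
  using (∈-filter⁻; ∈-concatMap⁻; ∈-concatMap⁺; ∈-map⁻; ∈-map⁺; ∈-upTo⁻; ∈-upTo⁺)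
open import Data.List.Relation.Unary.Any using (here; there)
import Data.List.Relation.Unary.All as All
open import Data.List.Extrema.Nat using (max; ⊥≤max; xs≤max)
open import Data.Bool using (true; false; if_then_else_; T)
open import Data.Bool.Properties using (T?)
open import Algebra.Bundles using (CommutativeSemiring)
open import Relation.Binary.PropositionalEquality as ≡ using (_≡_)

mutual
  cmp≡eq⇒≡ : ∀ t u → cmp t u ≡ eq → t ≡ u
  cmp≡eq⇒≡ (node ts) (node us) h = ≡.cong node (cmpL≡eq⇒≡ ts us h)

  cmpL≡eq⇒≡ : ∀ ts us → cmpL ts us ≡ eq → ts ≡ us
  cmpL≡eq⇒≡ []       []       _ = ≡.refl
  cmpL≡eq⇒≡ (t ∷ ts) (u ∷ us) with cmp t u in e
  ... | eq = λ h → ≡.cong₂ _∷_ (cmp≡eq⇒≡ t u e) (cmpL≡eq⇒≡ ts us h)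

eqB⇒≡ : ∀ t u → T (eqB t u) → t ≡ u
eqB⇒≡ t u with cmp t u in e
... | eq = λ _ → cmp≡eq⇒≡ t u e

∈-concatMap⁻-witness : ∀ {a b} {A : Set a} {B : Set b} (f : A → List B) xs {y} →
                        y ∈ concatMap f xs → ∃ λ x → x ∈ xs × y ∈ f x
∈-concatMap⁻-witness f xs y∈ = find (∈-concatMap⁻ f y∈)

mutual
  treesF-size : ∀ f n {t} → t ∈ treesF f n → size t ≡ n
  treesF-size (suc f) (suc n) t∈ with ∈-map⁻ node t∈
  ... | ts , ts∈ , ≡.refl = ≡.cong suc (forestsF-sizes f n ts∈)

  forestsF-sizes : ∀ f m {ts} → ts ∈ forestsF f m → sizes ts ≡ m
  forestsF-sizes _ zero (here ≡.refl) = ≡.refl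
  forestsF-sizes (suc f) (suc m) ts∈
    with ∈-concatMap⁻-witness _ (upTo (suc m)) ts∈
  ... | k , k∈ , ts∈′ with ∈-concatMap⁻-witness _ (treesF (suc f) (suc k)) ts∈′
  ... | t , t∈ , ts∈″ with ∈-map⁻ (t ∷_) ts∈″
  ... | us , us∈ , ≡.refl =
    ≡.trans (≡.cong₂ ℕ._+_ (treesF-size (suc f) (suc k) t∈) (forestsF-sizes f (m ∸ k) us∈))
            (≡.cong suc (ℕₚ.m+[n∸m]≡n (ℕₚ.≤-pred (∈-upTo⁻ k∈))))

∈-reps⁻ : ∀ n {t} → t ∈ reps n → t ∈ treesF n n × T (eqB (canon t) t)
∈-reps⁻ n = ∈-filter⁻ (λ p → T? (eqB (canon p) p)) {xs = treesF n n}

reps-canonical : ∀ n {t} → t ∈ reps n → canon t ≡ t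
reps-canonical n {t} t∈ = eqB⇒≡ (canon t) t (proj₂ (∈-reps⁻ n t∈))

reps-size : ∀ n {t} → t ∈ reps n → size t ≡ n
reps-size n t∈ = treesF-size n n (proj₁ (∈-reps⁻ n t∈))

module FiniteSums {c ℓ} (R : CommutativeSemiring c ℓ) where
  open CommutativeSemiring R
  open import Algebra.Properties.Semiring.Sum semiring
    using (sum; sum-cong-≋; sum-replicate-zero; ∑-distrib-+; *-distribˡ-sum)
  open import Algebra.Properties.CommutativeSemigroup +-commutativeSemigroup
    using () renaming (interchange to +-interchange)
  open import Relation.Binary.Reasoning.Setoid setoid

  -- ∑< (suc n) h unfolds definitionally to h 0 + ∑< n (λ k → h (suc k)).
  ∑< : ℕ → (ℕ → Carrier) → Carrier
  ∑< n h = sum {n} (λ i → h (toℕ i))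

  -- Definitionally equal to Series.sumL, so these lemmas apply to the sums in Defs.
  ∑ᴸ : List Carrier → Carrier
  ∑ᴸ = foldr _+_ 0#

  ∑<-cong : ∀ n {g h : ℕ → Carrier} → (∀ k → k < n → g k ≈ h k) → ∑< n g ≈ ∑< n h
  ∑<-cong n g≈h = sum-cong-≋ {n} (λ i → g≈h (toℕ i) (toℕ<n i))

  ∑<-zero : ∀ n {h : ℕ → Carrier} → (∀ k → h k ≈ 0#) → ∑< n h ≈ 0#
  ∑<-zero n h≈0 = trans (sum-cong-≋ {n} (λ i → h≈0 (toℕ i))) (sum-replicate-zero n)

  ∑<-extend : ∀ {n m} {h : ℕ → Carrier} → n ≤ m → (∀ k → n ≤ k → h k ≈ 0#) → ∑< n h ≈ ∑< m h
  ∑<-extend {zero}  {m}     _         h≈0 = sym (∑<-zero m (λ k → h≈0 k z≤n))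
  ∑<-extend {suc n} {suc m} (s≤s n≤m) h≈0 = +-congˡ (∑<-extend n≤m (λ k n≤k → h≈0 (suc k) (s≤s n≤k)))

  ∑<-+ : ∀ n g h → ∑< n (λ k → g k + h k) ≈ ∑< n g + ∑< n h
  ∑<-+ n g h = ∑-distrib-+ {n} (λ i → g (toℕ i)) (λ i → h (toℕ i))

  ∑<-*ˡ : ∀ n x h → ∑< n (λ k → x * h k) ≈ x * ∑< n h
  ∑<-*ˡ n x h = sym (*-distribˡ-sum {n} x (λ i → h (toℕ i)))

  ∑ᴸ-applyUpTo : ∀ {a} {A : Set a} (h : A → Carrier) (f : ℕ → A) n →
                 ∑ᴸ (map h (applyUpTo f n)) ≡ ∑< n (λ k → h (f k))
  ∑ᴸ-applyUpTo h f zero    = ≡.refl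
  ∑ᴸ-applyUpTo h f (suc n) = ≡.cong (h (f 0) +_) (∑ᴸ-applyUpTo h (λ k → f (suc k)) n)

  ∑ᴸ-upTo : ∀ h n → ∑ᴸ (map h (upTo n)) ≡ ∑< n h
  ∑ᴸ-upTo h = ∑ᴸ-applyUpTo h (λ k → k)

  ∑ᴸ-++ : ∀ xs ys → ∑ᴸ (xs ++ ys) ≈ ∑ᴸ xs + ∑ᴸ ys
  ∑ᴸ-++ []       ys = sym (+-identityˡ _)
  ∑ᴸ-++ (x ∷ xs) ys = trans (+-congˡ (∑ᴸ-++ xs ys)) (sym (+-assoc x _ _))

  ∑ᴸ-concatMap : ∀ {a} {A : Set a} (f : A → List Carrier) xs →
                 ∑ᴸ (concatMap f xs) ≈ ∑ᴸ (map (λ x → ∑ᴸ (f x)) xs)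
  ∑ᴸ-concatMap f []       = refl
  ∑ᴸ-concatMap f (x ∷ xs) = trans (∑ᴸ-++ (f x) (concatMap f xs)) (+-congˡ (∑ᴸ-concatMap f xs))

  ∑ᴸ-map-cong∈ : ∀ {a} {A : Set a} {g h : A → Carrier} xs →
                 (∀ x → x ∈ xs → g x ≈ h x) → ∑ᴸ (map g xs) ≈ ∑ᴸ (map h xs)
  ∑ᴸ-map-cong∈ []       _   = refl
  ∑ᴸ-map-cong∈ (x ∷ xs) g≈h = +-cong (g≈h x (here ≡.refl)) (∑ᴸ-map-cong∈ xs (λ y y∈ → g≈h y (there y∈)))

  ∑ᴸ-map-concatMap-cong : ∀ {a b} {A : Set a} {B : Set b} (φ : B → Carrier)
    (f : A → List B) (g : A → List Carrier) xs →
    (∀ x → ∑ᴸ (map φ (f x)) ≈ ∑ᴸ (g x)) →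
    ∑ᴸ (map φ (concatMap f xs)) ≈ ∑ᴸ (concatMap g xs)
  ∑ᴸ-map-concatMap-cong φ f g xs fx≈gx = begin
    ∑ᴸ (map φ (concatMap f xs))              ≡⟨ ≡.cong ∑ᴸ (map-concatMap φ f xs) ⟩
    ∑ᴸ (concatMap (λ x → map φ (f x)) xs)    ≈⟨ ∑ᴸ-concatMap _ xs ⟩
    ∑ᴸ (map (λ x → ∑ᴸ (map φ (f x))) xs)     ≈⟨ ∑ᴸ-map-cong∈ xs (λ x _ → fx≈gx x) ⟩
    ∑ᴸ (map (λ x → ∑ᴸ (g x)) xs)             ≈⟨ ∑ᴸ-concatMap g xs ⟨
    ∑ᴸ (concatMap g xs)                      ∎

  ∑ᴸ-map-+ : ∀ {a} {A : Set a} (g h : A → Carrier) xs →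
             ∑ᴸ (map (λ x → g x + h x) xs) ≈ ∑ᴸ (map g xs) + ∑ᴸ (map h xs)
  ∑ᴸ-map-+ g h []       = sym (+-identityˡ 0#)
  ∑ᴸ-map-+ g h (x ∷ xs) = trans (+-congˡ (∑ᴸ-map-+ g h xs)) (+-interchange _ _ _ _)

  ∑ᴸ-map-*ˡ : ∀ {a} {A : Set a} x (h : A → Carrier) xs →
              ∑ᴸ (map (λ y → x * h y) xs) ≈ x * ∑ᴸ (map h xs)
  ∑ᴸ-map-*ˡ x h []       = sym (zeroʳ x)
  ∑ᴸ-map-*ˡ x h (y ∷ xs) = trans (+-congˡ (∑ᴸ-map-*ˡ x h xs)) (sym (distribˡ x _ _))

  ∑ᴸ-map-∑< : ∀ {a} {A : Set a} n (G : A → ℕ → Carrier) xs →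
              ∑ᴸ (map (λ x → ∑< n (G x)) xs) ≈ ∑< n (λ j → ∑ᴸ (map (λ x → G x j) xs))
  ∑ᴸ-map-∑< zero    G xs = ∑ᴸ-zero xs
    where
    ∑ᴸ-zero : ∀ {a} {A : Set a} (xs : List A) → ∑ᴸ (map (λ _ → 0#) xs) ≈ 0#
    ∑ᴸ-zero []       = refl
    ∑ᴸ-zero (_ ∷ xs) = trans (+-identityˡ _) (∑ᴸ-zero xs)
  ∑ᴸ-map-∑< (suc n) G xs = trans (∑ᴸ-map-+ (λ x → G x 0) (λ x → ∑< n (λ k → G x (suc k))) xs)
                                 (+-congˡ (∑ᴸ-map-∑< n (λ x k → G x (suc k)) xs))

  -- Both sides are the sum of u k * v j * w (k + j) over k + j < M, grouped by k and by m = k + j.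
  ∑<-cauchy : ∀ M (u v w : ℕ → Carrier) →
    ∑< M (λ k → u k * ∑< (M ∸ k) (λ j → v j * w (k ℕ.+ j))) ≈
    ∑< M (λ m → w m * ∑< (suc m) (λ k → u k * v (m ∸ k)))
  ∑<-cauchy zero    u v w = refl
  ∑<-cauchy (suc M) u v w = begin
    u 0 * (v 0 * w 0 + X) + ∑< M (λ k → u (suc k) * ∑< (M ∸ k) (λ j → v j * w (suc (k ℕ.+ j))))
      ≈⟨ +-cong (distribˡ (u 0) _ _) (∑<-cauchy M (λ k → u (suc k)) v (λ k → w (suc k))) ⟩
    u 0 * (v 0 * w 0) + u 0 * X + ∑< M (λ m → w (suc m) * I m)
      ≈⟨ +-assoc _ _ _ ⟩
    u 0 * (v 0 * w 0) + (u 0 * X + ∑< M (λ m → w (suc m) * I m))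
      ≈⟨ +-cong head≈ (+-congʳ (∑<-*ˡ M (u 0) (λ m → v (suc m) * w (suc m)))) ⟨
    w 0 * (u 0 * v 0 + 0#) + (∑< M (λ m → u 0 * (v (suc m) * w (suc m))) + ∑< M (λ m → w (suc m) * I m))
      ≈⟨ +-congˡ (∑<-+ M (λ m → u 0 * (v (suc m) * w (suc m))) (λ m → w (suc m) * I m)) ⟨
    w 0 * (u 0 * v 0 + 0#) + ∑< M (λ m → u 0 * (v (suc m) * w (suc m)) + w (suc m) * I m)
      ≈⟨ +-congˡ (∑<-cong M (λ m _ → tail≈ m)) ⟩
    w 0 * (u 0 * v 0 + 0#) + ∑< M (λ m → w (suc m) * (u 0 * v (suc m) + I m)) ∎
    where
    X = ∑< M (λ j → v (suc j) * w (suc j))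
    I : ℕ → Carrier
    I m = ∑< (suc m) (λ k → u (suc k) * v (m ∸ k))
    head≈ : w 0 * (u 0 * v 0 + 0#) ≈ u 0 * (v 0 * w 0)
    head≈ = trans (*-congˡ (+-identityʳ _)) (trans (*-comm _ _) (*-assoc _ _ _))
    tail≈ : ∀ m → u 0 * (v (suc m) * w (suc m)) + w (suc m) * I m ≈ w (suc m) * (u 0 * v (suc m) + I m)
    tail≈ m = trans (+-congʳ (trans (sym (*-assoc _ _ _)) (*-comm _ _))) (sym (distribˡ _ _ _))

  ∑<-cauchy-bounded : ∀ {N M B} (u v w : ℕ → Carrier) → N ≤ M → N ≤ B → (∀ m → N ≤ m → w m ≈ 0#) →
    ∑< M (λ k → u k * ∑< B (λ j → v j * w (k ℕ.+ j))) ≈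
    ∑< N (λ m → w m * ∑< (suc m) (λ k → u k * v (m ∸ k)))
  ∑<-cauchy-bounded {N} {M} {B} u v w N≤M N≤B w≈0 = begin
    ∑< M (λ k → u k * ∑< B (λ j → v j * w (k ℕ.+ j)))
      ≈⟨ ∑<-cong M (λ k _ → *-congˡ {u k} (∑<-extend (ℕₚ.≤-trans (ℕₚ.m∸n≤m N k) N≤B) (vw≈0 k))) ⟨
    ∑< M (λ k → u k * ∑< (N ∸ k) (λ j → v j * w (k ℕ.+ j)))
      ≈⟨ ∑<-extend {h = truncated} N≤M truncated≈0 ⟨
    ∑< N (λ k → u k * ∑< (N ∸ k) (λ j → v j * w (k ℕ.+ j)))
      ≈⟨ ∑<-cauchy N u v w ⟩
    ∑< N (λ m → w m * ∑< (suc m) (λ k → u k * v (m ∸ k))) ∎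
    where
    truncated : ℕ → Carrier
    truncated k = u k * ∑< (N ∸ k) (λ j → v j * w (k ℕ.+ j))
    truncated≈0 : ∀ k → N ≤ k → truncated k ≈ 0#
    truncated≈0 k N≤k rewrite ℕₚ.m≤n⇒m∸n≡0 N≤k = zeroʳ (u k)
    vw≈0 : ∀ k j → N ∸ k ≤ j → v j * w (k ℕ.+ j) ≈ 0#
    vw≈0 k j N∸k≤j = trans (*-congˡ (w≈0 _ (ℕₚ.≤-trans (ℕₚ.m≤n+m∸n N k) (ℕₚ.+-monoʳ-≤ k N∸k≤j)))) (zeroʳ _)

module _ {c ℓ} (F : Field c ℓ) where
  open Series F
  open FiniteSums commutativeSemiring
  open import Algebra.Properties.Semiring.Mult semiring using (×1-homo-*) renaming (_×_ to _×ₙ_)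
  open import Algebra.Properties.CommutativeSemigroup *-commutativeSemigroup using (x∙yz≈y∙xz)
  open import Relation.Binary.Reasoning.Setoid setoid

  natK≡×1# : ∀ n → natK n ≡ n ×ₙ 1#
  natK≡×1# zero    = ≡.refl
  natK≡×1# (suc n) = ≡.cong (1# +_) (natK≡×1# n)

  natK-* : ∀ m n → natK (m ℕ.* n) ≈ natK m * natK n
  natK-* m n rewrite natK≡×1# (m ℕ.* n) | natK≡×1# m | natK≡×1# n = ×1-homo-* m n

  factK-suc : ∀ k → factK (suc k) ≈ factK k * natK (suc k)
  factK-suc k = trans (natK-* (suc k) (k !)) (*-comm _ _)

  factK≉0 : CharZero → ∀ k → ¬ (factK k ≈ 0#)
  factK≉0 charZero k with k ! | ℕₚ.1≤n! k
  ... | suc m | _ = charZero m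

  factK⁻¹*factK : CharZero → ∀ k → factK k ⁻¹ * factK k ≈ 1#
  factK⁻¹*factK charZero k = trans (*-comm _ _) (⁻¹-inverse (factK k) (factK≉0 charZero k))

  coeff-derivFrom : ∀ n q k → coeff (derivFrom n q) k ≈ natK (k ℕ.+ n) * coeff q k
  coeff-derivFrom n []      k       = sym (zeroʳ _)
  coeff-derivFrom n (y ∷ q) zero    = refl
  coeff-derivFrom n (y ∷ q) (suc k) =
    trans (coeff-derivFrom (suc n) q k) (*-congʳ (reflexive (≡.cong natK (ℕₚ.+-suc k n))))

  coeff-deriv : ∀ q k → coeff (deriv q) k ≈ natK (suc k) * coeff q (suc k)
  coeff-deriv []      k = sym (zeroʳ _)
  coeff-deriv (y ∷ q) k = trans (coeff-derivFrom 1 q k) (*-congʳ (reflexive (≡.cong natK (ℕₚ.+-comm k 1))))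

  coeff-≥length : ∀ q k → length q ≤ k → coeff q k ≡ 0#
  coeff-≥length []      k       _         = ≡.refl
  coeff-≥length (y ∷ q) (suc k) (s≤s q≤k) = coeff-≥length q k q≤k

  pairFrom≈∑< : ∀ as n q → pairFrom as n q ≈ ∑< (length q) (λ k → as (k ℕ.+ n) * coeff q k)
  pairFrom≈∑< as n []      = refl
  pairFrom≈∑< as n (y ∷ q) = +-cong (*-comm y (as n)) (trans (pairFrom≈∑< as (suc n) q)
    (∑<-cong (length q) (λ k _ → *-congʳ {coeff q k} (reflexive (≡.cong as (ℕₚ.+-suc k n))))))

  pairing≈∑< : ∀ as q → pairing as q ≈ ∑< (length q) (λ k → as k * coeff q k)
  pairing≈∑< as q = trans (pairFrom≈∑< as 0 q)
    (∑<-cong (length q) (λ k _ → *-congʳ {coeff q k} (reflexive (≡.cong as (ℕₚ.+-identityʳ k)))))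

  -- The terms of (x ↷ y) S with the factor y T' split off, exhibiting (x ↷ y) S as a linear form in y.
  graftTerms : Ser → RTree → List (Carrier × RTree)
  graftTerms x S =
    concatMap (λ i →
      concatMap (λ T →
        concatMap (λ T' →
          map (λ U → (if isoB U S then x T else 0#) , T') (graftAt T T'))
          (reps (size S ∸ i)))
        (reps i))
      (upTo (size S))

  applyTerm : Ser → Carrier × RTree → Carrier
  applyTerm y p = proj₁ p * y (proj₂ p)

  ↷≈∑graftTerms : ∀ x y S → (x ↷ y) S ≈ ∑ᴸ (map (applyTerm y) (graftTerms x S))
  ↷≈∑graftTerms x y S = sym
    (∑ᴸ-map-concatMap-cong (applyTerm y) _ _ (upTo (size S)) λ i →
     ∑ᴸ-map-concatMap-cong (applyTerm y) _ _ (reps i) λ T →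
     ∑ᴸ-map-concatMap-cong (applyTerm y) _ _ (reps (size S ∸ i)) λ T' →
     trans (reflexive (≡.cong ∑ᴸ (≡.sym (map-∘ (graftAt T T')))))
           (∑ᴸ-map-cong∈ (graftAt T T') (λ U _ → if-*ʳ (isoB U S) (x T) (y T'))))
    where
    if-*ʳ : ∀ b u v → (if b then u else 0#) * v ≈ (if b then u * v else 0#)
    if-*ʳ true  u v = refl
    if-*ʳ false u v = zeroˡ v

  graftTerms-reps : ∀ x S {p} → p ∈ graftTerms x S → ∃ λ j → j ≤ size S × proj₂ p ∈ reps j
  graftTerms-reps x S p∈
    with ∈-concatMap⁻-witness _ (upTo (size S)) p∈
  ... | i , _ , p∈′ with ∈-concatMap⁻-witness _ (reps i) p∈′
  ... | T , _ , p∈″ with ∈-concatMap⁻-witness _ (reps (size S ∸ i)) p∈″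
  ... | T' , T'∈ , p∈‴ with ∈-map⁻ _ p∈‴
  ... | _ , _ , ≡.refl = size S ∸ i , ℕₚ.m∸n≤m (size S) i , T'∈

  AgreeBelow : ℕ → Ser → Ser → Set ℓ
  AgreeBelow n y z = ∀ {j T} → j ≤ n → T ∈ reps j → y T ≈ z T

  ↷-local : ∀ x {y z} S → AgreeBelow (size S) y z → (x ↷ y) S ≈ (x ↷ z) S
  ↷-local x {y} {z} S y≈z = begin
    (x ↷ y) S                                ≈⟨ ↷≈∑graftTerms x y S ⟩
    ∑ᴸ (map (applyTerm y) (graftTerms x S))  ≈⟨ ∑ᴸ-map-cong∈ (graftTerms x S) applyTerm≈ ⟩
    ∑ᴸ (map (applyTerm z) (graftTerms x S))  ≈⟨ ↷≈∑graftTerms x z S ⟨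
    (x ↷ z) S                                ∎
    where
    applyTerm≈ : ∀ p → p ∈ graftTerms x S → applyTerm y p ≈ applyTerm z p
    applyTerm≈ p p∈ = let (_ , j≤ , T∈) = graftTerms-reps x S p∈ in *-congˡ (y≈z j≤ T∈)

  ↷-congʳ : ∀ x {y z} → y ≈ᵀ z → ∀ S → (x ↷ y) S ≈ (x ↷ z) S
  ↷-congʳ x {y} {z} y≈z S = ↷-local x {y} {z} S λ {j} {T} _ T∈ →
    ≡.subst (λ U → y U ≈ z U) (reps-canonical j T∈) (y≈z T)

  ↷-·ₛ : ∀ x λ' y S → (x ↷ (λ' ·ₛ y)) S ≈ λ' * (x ↷ y) S
  ↷-·ₛ x λ' y S = begin
    (x ↷ (λ' ·ₛ y)) S                                    ≈⟨ ↷≈∑graftTerms x (λ' ·ₛ y) S ⟩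
    ∑ᴸ (map (applyTerm (λ' ·ₛ y)) (graftTerms x S))
      ≈⟨ ∑ᴸ-map-cong∈ (graftTerms x S) (λ (w , T) _ → x∙yz≈y∙xz w λ' (y T)) ⟩
    ∑ᴸ (map (λ p → λ' * applyTerm y p) (graftTerms x S))  ≈⟨ ∑ᴸ-map-*ˡ λ' (applyTerm y) (graftTerms x S) ⟩
    λ' * ∑ᴸ (map (applyTerm y) (graftTerms x S))          ≈⟨ *-congˡ (↷≈∑graftTerms x y S) ⟨
    λ' * (x ↷ y) S                                        ∎

  ↷-∑< : ∀ x n (h : ℕ → Ser) S → (x ↷ (λ T → ∑< n (λ j → h j T))) S ≈ ∑< n (λ j → (x ↷ h j) S)
  ↷-∑< x n h S = begin
    (x ↷ (λ T → ∑< n (λ j → h j T))) S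
      ≈⟨ ↷≈∑graftTerms x _ S ⟩
    ∑ᴸ (map (λ (w , T) → w * ∑< n (λ j → h j T)) (graftTerms x S))
      ≈⟨ ∑ᴸ-map-cong∈ (graftTerms x S) (λ (w , T) _ → ∑<-*ˡ n w (λ j → h j T)) ⟨
    ∑ᴸ (map (λ (w , T) → ∑< n (λ j → w * h j T)) (graftTerms x S))
      ≈⟨ ∑ᴸ-map-∑< n (λ (w , T) j → w * h j T) (graftTerms x S) ⟩
    ∑< n (λ j → ∑ᴸ (map (applyTerm (h j)) (graftTerms x S)))
      ≈⟨ ∑<-cong n (λ j _ → ↷≈∑graftTerms x (h j) S) ⟨
    ∑< n (λ j → (x ↷ h j) S) ∎

  AgreeBelow-↷ : ∀ x {n y z} → AgreeBelow n y z → AgreeBelow n (x ↷ y) (x ↷ z)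
  AgreeBelow-↷ x {n} {y} {z} y≈z {j} j≤n T∈ =
    ↷-local x {y} {z} _ λ i≤size → y≈z (ℕₚ.≤-trans i≤size size≤n)
    where size≤n = ≡.subst (_≤ n) (≡.sym (reps-size j T∈)) j≤n

  iter↷-local : ∀ x {y z} S → AgreeBelow (size S) y z → y S ≈ z S → ∀ k → iter↷ x k y S ≈ iter↷ x k z S
  iter↷-local x         S _   yS≈zS zero    = yS≈zS
  iter↷-local x {y} {z} S y≈z _     (suc k) = ↷-local x {iter↷ x k y} {iter↷ x k z} S (iterate k)
    where
    iterate : ∀ k → AgreeBelow (size S) (iter↷ x k y) (iter↷ x k z)
    iterate zero    = y≈z
    iterate (suc k) = AgreeBelow-↷ x {y = iter↷ x k y} {iter↷ x k z} (iterate k)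

  iter↷-linear : ∀ x k n (λs : ℕ → Carrier) (y : ℕ → Ser) T →
    iter↷ x k (λ U → ∑< n (λ j → λs j * y j U)) T ≈ ∑< n (λ j → λs j * iter↷ x k (y j) T)
  iter↷-linear x zero    n λs y T = refl
  iter↷-linear x (suc k) n λs y T = begin
    (x ↷ iter↷ x k (λ U → ∑< n (λ j → λs j * y j U))) T
      ≈⟨ ↷-congʳ x (λ U → iter↷-linear x k n λs y (canon U)) T ⟩
    (x ↷ (λ U → ∑< n (λ j → λs j * iter↷ x k (y j) U))) T
      ≈⟨ ↷-∑< x n (λ j → λs j ·ₛ iter↷ x k (y j)) T ⟩
    ∑< n (λ j → (x ↷ (λs j ·ₛ iter↷ x k (y j))) T)
      ≈⟨ ∑<-cong n (λ j _ → ↷-·ₛ x (λs j) (iter↷ x k (y j)) T) ⟩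
    ∑< n (λ j → λs j * iter↷ x (suc k) (y j) T) ∎

  iter↷-+ : ∀ x k j y → iter↷ x k (iter↷ x j y) ≡ iter↷ x (k ℕ.+ j) y
  iter↷-+ x zero    j y = ≡.refl
  iter↷-+ x (suc k) j y = ≡.cong (x ↷_) (iter↷-+ x k j y)

  FTimesGIsT⇒convolution : ∀ {cs as} → FTimesGIsT cs as →
    ∀ m → ∑< (suc m) (λ k → fCoeff cs (suc k) * gCoeff as (m ∸ k)) ≈ tCoeff (suc m)
  FTimesGIsT⇒convolution {cs} {as} f*g≈t m = begin
    ∑< (suc m) (λ k → fCoeff cs (suc k) * gCoeff as (m ∸ k))            ≈⟨ +-identityˡ _ ⟨
    0# + ∑< (suc m) (λ k → fCoeff cs (suc k) * gCoeff as (m ∸ k))       ≈⟨ +-congʳ (zeroˡ _) ⟨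
    ∑< (suc (suc m)) (λ i → fCoeff cs i * gCoeff as (suc m ∸ i))        ≡⟨ ∑ᴸ-upTo _ (suc (suc m)) ⟨
    ∑ᴸ (map (λ i → fCoeff cs i * gCoeff as (suc m ∸ i)) (upTo (suc (suc m)))) ≈⟨ f*g≈t (suc m) ⟩
    tCoeff (suc m)                                                      ∎

  module ODESolution (charZero : CharZero) (as : ℕ → Carrier) (P : SerT)
      (ode : ∀ m → atDeg (derivT P) m ≈ᵀ (pairingT as P ↷ₜ P) m)
      (init : atDeg P 0 ≈ᵀ bulletS) where

    a : Ser
    a = pairingT as P

    iterate• : ℕ → Ser
    iterate• k = iter↷ a k bulletS

    iterate•≈factK·ₛP : ∀ k → iterate• k ≈ᵀ (factK k ·ₛ atDeg P k)
    iterate•≈factK·ₛP zero S = begin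
      bulletS (canon S)  ≈⟨ init S ⟨
      p                  ≈⟨ *-identityˡ p ⟨
      1# * p             ≈⟨ *-congʳ (+-identityʳ 1#) ⟨
      factK 0 * p        ∎
      where p = atDeg P 0 (canon S)
    iterate•≈factK·ₛP (suc k) S = begin
      (a ↷ iterate• k) (canon S)               ≈⟨ ↷-congʳ a (iterate•≈factK·ₛP k) (canon S) ⟩
      (a ↷ (factK k ·ₛ atDeg P k)) (canon S)   ≈⟨ ↷-·ₛ a (factK k) (atDeg P k) (canon S) ⟩
      factK k * (a ↷ atDeg P k) (canon S)      ≈⟨ *-congˡ (ode k S) ⟨
      factK k * coeff (deriv (P (canon S))) k  ≈⟨ *-congˡ (coeff-deriv (P (canon S)) k) ⟩
      factK k * (natK (suc k) * p)             ≈⟨ *-assoc _ _ _ ⟨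
      factK k * natK (suc k) * p               ≈⟨ *-congʳ (factK-suc k) ⟨
      factK (suc k) * p                        ∎
      where p = atDeg P (suc k) (canon S)

    coeffP-vanishes : ∀ S {k} → length (P (canon S)) ≤ k → ∀ λ' → λ' * atDeg P k (canon S) ≈ 0#
    coeffP-vanishes S {k} len≤k λ' =
      trans (*-congˡ (reflexive (coeff-≥length (P (canon S)) k len≤k))) (zeroʳ λ')

    iterate•-vanishes : ∀ S {k} → length (P (canon S)) ≤ k → iterate• k (canon S) ≈ 0#
    iterate•-vanishes S {k} len≤k = trans (iterate•≈factK·ₛP k S) (coeffP-vanishes S len≤k (factK k))

    gCoeff*iterate• : ∀ k S → gCoeff as k * iterate• k (canon S) ≈ as k * atDeg P k (canon S)
    gCoeff*iterate• k S = begin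
      as k * factK k ⁻¹ * iterate• k (canon S)  ≈⟨ *-congˡ (iterate•≈factK·ₛP k S) ⟩
      as k * factK k ⁻¹ * (factK k * p)         ≈⟨ *-assoc _ _ _ ⟩
      as k * (factK k ⁻¹ * (factK k * p))       ≈⟨ *-congˡ (*-assoc _ _ _) ⟨
      as k * (factK k ⁻¹ * factK k * p)         ≈⟨ *-congˡ (*-congʳ (factK⁻¹*factK charZero k)) ⟩
      as k * (1# * p)                           ≈⟨ *-congˡ (*-identityˡ p) ⟩
      as k * p                                  ∎
      where p = atDeg P k (canon S)

    aTruncated : ℕ → Ser
    aTruncated B T = ∑< B (λ j → gCoeff as j * iterate• j T)

    a≈aTruncated : ∀ {B} S → length (P (canon S)) ≤ B → a (canon S) ≈ aTruncated B (canon S)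
    a≈aTruncated {B} S len≤B = begin
      a (canon S)
        ≈⟨ pairing≈∑< as (P (canon S)) ⟩
      ∑< (length (P (canon S))) (λ k → as k * atDeg P k (canon S))
        ≈⟨ ∑<-extend len≤B (λ k len≤k → coeffP-vanishes S len≤k (as k)) ⟩
      ∑< B (λ k → as k * atDeg P k (canon S))
        ≈⟨ ∑<-cong B (λ k _ → gCoeff*iterate• k S) ⟨
      aTruncated B (canon S) ∎

    a-expansion : HasSum (λ k → gCoeff as k ·ₛ iterate• k) a
    a-expansion S = length (P (canon S)) , λ M len≤M →
      trans (reflexive (∑ᴸ-upTo _ M)) (sym (a≈aTruncated S len≤M))

    iter↷-a-expansion : ∀ S N → ∃ λ B → N ≤ B ×
      ∀ k → iter↷ a k a (canon S) ≈ ∑< B (λ j → gCoeff as j * iterate• (k ℕ.+ j) (canon S))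
    iter↷-a-expansion S N = B , ⊥≤max N lengths , λ k → begin
      iter↷ a k a (canon S)
        ≈⟨ iter↷-local a (canon S) a≈aTruncated-below (a≈aTruncated S len≤B) k ⟩
      iter↷ a k (aTruncated B) (canon S)
        ≈⟨ iter↷-linear a k B (gCoeff as) iterate• (canon S) ⟩
      ∑< B (λ j → gCoeff as j * iter↷ a k (iterate• j) (canon S))
        ≈⟨ ∑<-cong B (λ j _ → *-congˡ {gCoeff as j} (reflexive (≡.cong-app (iter↷-+ a k j bulletS) (canon S)))) ⟩
      ∑< B (λ j → gCoeff as j * iterate• (k ℕ.+ j) (canon S)) ∎
      where
      -- B bounds the t-degree of P at S and at every canonical tree with at most |S| vertices.
      lengthsOf : ℕ → List ℕ
      lengthsOf j = map (λ T → length (P T)) (reps j)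
      lengths : List ℕ
      lengths = length (P (canon S)) ∷ concatMap lengthsOf (upTo (suc (size (canon S))))
      B : ℕ
      B = max N lengths
      len≤B : length (P (canon S)) ≤ B
      len≤B = All.lookup (xs≤max N lengths) (here ≡.refl)
      reps-len≤B : ∀ {j T} → j ≤ size (canon S) → T ∈ reps j → length (P T) ≤ B
      reps-len≤B j≤ T∈ = All.lookup (xs≤max N lengths)
        (there (∈-concatMap⁺ lengthsOf (lose (∈-upTo⁺ (s≤s j≤)) (∈-map⁺ (λ U → length (P U)) T∈))))
      a≈aTruncated-below : AgreeBelow (size (canon S)) a (aTruncated B)
      a≈aTruncated-below {j} {T} j≤ T∈ =
        ≡.subst (λ U → length (P U) ≤ B → a U ≈ aTruncated B U) (reps-canonical j T∈)
          (a≈aTruncated T) (reps-len≤B j≤ T∈)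

    f-inverse : ∀ {cs} → FTimesGIsT cs as → FArrow cs a bulletS
    f-inverse {cs} f*g≈t S = suc (suc L) , λ { (suc M) (s≤s L<M) → partialSum≈bullet M L<M }
      where
      L : ℕ
      L = length (P (canon S))
      u : ℕ → Carrier
      u k = fCoeff cs (suc k)
      w : ℕ → Carrier
      w m = iterate• m (canon S)
      partialSum≈bullet : ∀ M → L < M →
        ∑ᴸ (map (λ k → fCoeff cs k * pow↷ a k (canon S)) (upTo (suc M))) ≈ bulletS (canon S)
      partialSum≈bullet M L<M = let (B , L<B , iter↷-a≈) = iter↷-a-expansion S (suc L) in begin
        ∑ᴸ (map (λ k → fCoeff cs k * pow↷ a k (canon S)) (upTo (suc M)))
          ≡⟨ ∑ᴸ-upTo (λ k → fCoeff cs k * pow↷ a k (canon S)) (suc M) ⟩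
        0# * 0# + ∑< M (λ k → u k * iter↷ a k a (canon S))
          ≈⟨ trans (+-congʳ (zeroˡ 0#)) (+-identityˡ _) ⟩
        ∑< M (λ k → u k * iter↷ a k a (canon S))
          ≈⟨ ∑<-cong M (λ k _ → *-congˡ {u k} (iter↷-a≈ k)) ⟩
        ∑< M (λ k → u k * ∑< B (λ j → gCoeff as j * w (k ℕ.+ j)))
          ≈⟨ ∑<-cauchy-bounded u (gCoeff as) w L<M L<B (λ m L<m → iterate•-vanishes S (ℕₚ.<⇒≤ L<m)) ⟩
        ∑< (suc L) (λ m → w m * ∑< (suc m) (λ k → u k * gCoeff as (m ∸ k)))
          ≈⟨ ∑<-cong (suc L) (λ m _ → *-congˡ {w m} (FTimesGIsT⇒convolution f*g≈t m)) ⟩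
        ∑< (suc L) (λ m → w m * tCoeff (suc m))
          ≈⟨ +-cong (*-identityʳ (w 0)) (∑<-zero L (λ m → zeroʳ (w (suc m)))) ⟩
        w 0 + 0#
          ≈⟨ +-identityʳ (w 0) ⟩
        bulletS (canon S) ∎

-- The hypothesis c₁ ≠ 0 is implied by f g = t (compare the coefficients of t), so it is not needed.
proposition2p11 : ∀ {c ℓ} (F : Field c ℓ) → let open Series F in
    CharZero →
    (cs as : ℕ → Carrier) →
    ¬ (cs 1 ≈ 0#) →
    FTimesGIsT cs as →
    (P : SerT) →
    (∀ m → atDeg (derivT P) m ≈ᵀ (pairingT as P ↷ₜ P) m) →
    atDeg P 0 ≈ᵀ bulletS →
    HasSum (λ k → gCoeff as k ·ₛ iter↷ (pairingT as P) k bulletS) (pairingT as P)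
      × FArrow cs (pairingT as P) bulletS
proposition2p11 F charZero cs as _ f*g≈t P ode init = a-expansion , f-inverse f*g≈t
  where open ODESolution F charZero as P ode init
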